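{- Let $G$ be a connected graph with a colouring $f\colon V(G)\to\{1,0,\hat 0\}$. Let $B$ be a block of $G$ that contains exactly one cut vertex $v$ of $G$, let $H=B-v$ (a leaf component with connection vertex $v$) and $H'=G[V(H)\cup\{v\}]$. For $i\in\{1,0,\hat0\}$ let $S^{H'}_{v=i}$ be a minimum $f^{H'}_{v=i}$-respecting simultaneous dominating set of $H'$ and $S^{G-H}_{v=i}$ a minimum $f^{G-H}_{v=i}$-respecting simultaneous dominating set of $G-H$. Then: (a) if $|S^{H'}_{v=0}|=|S^{H'}_{v=\hat0}|=|S^{H'}_{v=1}|$, then $S^{H'}_{v=1}\cup S^{G-H}_{v=1}$ is a minimum $f$-respecting simultaneous dominating set of $G$; (b) if $|S^{H'}_{v=0}|<|S^{H'}_{v=\hat0}|=|S^{H'}_{v=1}|$, then $S^{H'}_{v=0}\cup S^{G-H}_{v=f(v)}$ is a minimum $f$-respecting simultaneous dominating set of $G$; (c) if $|S^{H'}_{v=0}|=|S^{H'}_{v=\hat0}|<|S^{H'}_{v=1}|$, then $S^{H'}_{v=\hat0}\cup S^{G-H}_{v=\mathrm{best}\{f(v),0\}}$ is a minimum $f$-respecting simultaneous dominating set of $G$.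
   Context: All graphs are finite, simple and undirected. A cut vertex of $G$ is a vertex whose removal increases the number of connected components; a graph without cut vertex is $2$-connected; a block is a maximal $2$-connected subgraph. For a connected graph $G$ and $S\subseteq V(G)$, a vertex $w$ is simultaneously dominated by $S$ if in every spanning tree $T$ of $G$, $w\in S$ or $w$ has a neighbour in $T$ belonging to $S$. For a colouring $f\colon V(G)\to\{1,0,\hat 0\}$, a set $S\subseteq V(G)$ is an $f$-respecting simultaneous dominating set of $G$ if $f^{ -1}(1)\subseteq S$ and every vertex of $f^{ -1}(\hat 0)$ is simultaneously dominated by $S$ (in $G$). For an induced subgraph $K$ of $G$, $f^K$ is the restriction of $f$ to $V(K)$, and for $v\in V(K)$ and $i\in\{1,0,\hat0\}$, $f^K_{v=i}$ is the colouring of $V(K)$ equal to $f^K$ except that $v$ gets colour $i$. Colours are ordered $1$ better than $0$ better than $\hat 0$, and $\mathrm{best}\{\cdot\}$ denotes the best colour of a set of colours. -}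

module Defs where

open import Data.Nat using (ℕ; _≤_)
open import Data.Bool using (Bool; true; false; if_then_else_)
open import Data.Fin using (Fin; _≟_)
open import Data.Fin.Subset using (Subset; _∈_; _⊆_; ⊤; ∁; _∪_; ⁅_⁆; _-_; ∣_∣)
open import Data.List using (List; []; _∷_; _++_; [_]; length)
open import Data.List.Relation.Unary.Linked using (Linked)
open import Data.List.Relation.Unary.Unique.Propositional using (Unique)
open import Data.Product using (Σ; ∃; ∃-syntax; _×_)
open import Data.Sum using (_⊎_)
open import Relation.Nullary using (¬_; yes; no)
open import Relation.Binary.PropositionalEquality using (_≡_; _≢_)

record Graph (n : ℕ) : Set where
  field
    adj    : Fin n → Fin n → Bool
    sym    : ∀ u v → adj u v ≡ adj v u
    irrefl : ∀ v → adj v v ≡ false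
open Graph public

module _ {n : ℕ} where

  data Reach (E : Fin n → Fin n → Set) (u : Fin n) : Fin n → Set where
    here : Reach E u u
    step : ∀ {v w} → Reach E u v → E v w → Reach E u w

  IAdj : Graph n → Subset n → Fin n → Fin n → Set
  IAdj G X u v = (adj G u v ≡ true) × u ∈ X × v ∈ X

  Connected : Graph n → Subset n → Set
  Connected G X = ∀ u w → u ∈ X → w ∈ X → Reach (IAdj G X) u w

  -- v is a cut vertex of G[X]: removing v separates two vertices that
  -- were in the same component (equivalently: the number of components grows)
  CutVertex : Graph n → Subset n → Fin n → Set
  CutVertex G X v =
    v ∈ X × (∃[ u ] ∃[ w ] (u ∈ X × w ∈ X × u ≢ v × w ≢ v ×
      Reach (IAdj G X) u w × ¬ Reach (IAdj G (X - v)) u w))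

  TwoConnected : Graph n → Subset n → Set
  TwoConnected G X = Connected G X × (∀ v → ¬ CutVertex G X v)

  IsBlock : Graph n → Subset n → Set
  IsBlock G X = TwoConnected G X × (∀ Y → X ⊆ Y → TwoConnected G Y → Y ⊆ X)

  -- edge sets, given as symmetric Bool-valued relations
  EdgeRel : (Fin n → Fin n → Bool) → Fin n → Fin n → Set
  EdgeRel T u v = T u v ≡ true

  IsCycle : (Fin n → Fin n → Bool) → List (Fin n) → Set
  IsCycle T [] = Data.Empty.⊥
    where import Data.Empty
  IsCycle T (x ∷ xs) =
    (2 ≤ length xs) × Unique (x ∷ xs) × Linked (EdgeRel T) ((x ∷ xs) ++ [ x ])

  record IsSpanningTree (G : Graph n) (X : Subset n) (T : Fin n → Fin n → Bool) : Set where
    field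
      sub     : ∀ u v → T u v ≡ true → IAdj G X u v
      tsym    : ∀ u v → T u v ≡ T v u
      conn    : ∀ u v → u ∈ X → v ∈ X → Reach (EdgeRel T) u v
      acyclic : ∀ c → ¬ IsCycle T c

  SimDominated : Graph n → Subset n → Subset n → Fin n → Set
  SimDominated G X S w = ∀ T → IsSpanningTree G X T →
    w ∈ S ⊎ (∃[ u ] (T w u ≡ true × u ∈ S))

data Colour : Set where
  c1 c0 c0̂ : Colour

best : Colour → Colour → Colour
best c1 _ = c1
best _ c1 = c1
best c0 _ = c0
best _ c0 = c0
best c0̂ c0̂ = c0̂

module _ {n : ℕ} where

  recolour : (Fin n → Colour) → Fin n → Colour → Fin n → Colour
  recolour f v i u with u ≟ v
  ... | yes _ = i
  ... | no  _ = f u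

  -- S is an f-respecting simultaneous dominating set of G[X]
  -- (only the values of f on X matter: f restricted to X)
  Respecting : Graph n → Subset n → (Fin n → Colour) → Subset n → Set
  Respecting G X f S =
    S ⊆ X ×
    (∀ u → u ∈ X → f u ≡ c1 → u ∈ S) ×
    (∀ u → u ∈ X → f u ≡ c0̂ → SimDominated G X S u)

  MinRespecting : Graph n → Subset n → (Fin n → Colour) → Subset n → Set
  MinRespecting G X f S =
    Respecting G X f S × (∀ S′ → Respecting G X f S′ → ∣ S ∣ ≤ ∣ S′ ∣)

module Submission where

-- The block B with unique cut vertex v separates G at v: the sides X = B and
-- Y = ∁ B ∪ ⁅ v ⁆ cover G, share only v, and every edge leaving either side
-- starts at v (the block lemma, proved from the maximality of B).  For such a
-- separation, spanning trees of G restrict to spanning trees of each side and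
-- spanning trees of the sides glue to spanning trees of G.  Hence simultaneous
-- domination transfers between G and the sides (at v only up to a case split),
-- respecting sets of G restrict to respecting sets of the sides whose sizes add
-- up to at most ∣ S ∣ (+1 if v ∈ S), and respecting sets of the sides combine to
-- one of G.  The three cases of the lemma then follow by comparing sizes.

open import Defs
open import Data.Nat using (ℕ; zero; suc; _+_; _≤_; _<_; s≤s; s≤s⁻¹; _≤?_)
import Data.Nat.Properties as ℕ
open import Data.Bool using (Bool; true; false)
import Data.Bool as Bool
open import Data.Fin using (Fin; _≟_)
open import Data.Fin.Properties using (any?)
open import Data.Fin.Subset
  using (Subset; _∈_; _∉_; _⊆_; ⊤; ⊥; ∁; _∪_; _∩_; ⁅_⁆; _-_; _─_; ∣_∣; inside; outside)
open import Data.Vec using ([]; _∷_; here; there)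
open import Data.Fin.Subset.Properties
open import Data.List using (List; []; _∷_; _++_; [_]; length)
open import Data.List.Properties using (++-assoc; length-++)
open import Data.List.Relation.Unary.All as All using (All; []; _∷_)
import Data.List.Relation.Unary.All.Properties as AllP
open import Data.List.Relation.Unary.Any as Any using (here; there)
import Data.List.Relation.Unary.Any.Properties as AnyP
open import Data.List.Relation.Unary.AllPairs using ([]; _∷_)
import Data.List.Relation.Unary.AllPairs.Properties as AllPairsP
open import Data.List.Relation.Unary.Linked using (Linked; []; [-]; _∷_)
open import Data.List.Relation.Unary.Unique.Propositional using (Unique)
open import Data.List.Membership.Propositional using () renaming (_∈_ to _∈ˡ_)
open import Data.List.Membership.Propositional.Properties using (∈-∃++)
open import Data.Product using (Σ; ∃-syntax; _×_; _,_; proj₁; proj₂)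
open import Data.Sum using (_⊎_; inj₁; inj₂)
open import Data.Empty using (⊥-elim) renaming (⊥ to Empty)
open import Relation.Nullary using (¬_; ¬?; Dec; yes; no; does; contradiction)
open import Relation.Nullary.Decidable using (dec-true; decidable-stable; _×-dec_; _⊎-dec_)
open import Relation.Binary.PropositionalEquality
  using (_≡_; _≢_; refl; trans; cong; subst; subst₂) renaming (sym to ≡-sym)

module Walks {n : ℕ} where

  reach-map : {E E′ : Fin n → Fin n → Set} → (∀ {a b} → E a b → E′ a b) →
              ∀ {u w} → Reach E u w → Reach E′ u w
  reach-map f here       = here
  reach-map f (step p e) = step (reach-map f p) (f e)

  reach-trans : {E : Fin n → Fin n → Set} {u v w : Fin n} →
                Reach E u v → Reach E v w → Reach E u w
  reach-trans p here       = p
  reach-trans p (step q e) = step (reach-trans p q) e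

  reach-sym : {E : Fin n → Fin n → Set} → (∀ {a b} → E a b → E b a) →
              ∀ {u w} → Reach E u w → Reach E w u
  reach-sym s here       = here
  reach-sym s (step p e) = reach-trans (step here (s e)) (reach-sym s p)

  iadj-sym : {G : Graph n} {X : Subset n} {a b : Fin n} → IAdj G X a b → IAdj G X b a
  iadj-sym {G} {a = a} {b} (e , a∈ , b∈) = trans (Graph.sym G b a) e , b∈ , a∈

  leaving-edge : {E : Fin n → Fin n → Set} {R : Subset n} {r u : Fin n} →
                 Reach E r u → r ∈ R → u ∉ R → ∃[ a ] ∃[ b ] (a ∈ R × b ∉ R × E a b)
  leaving-edge here r∈ u∉ = contradiction r∈ u∉
  leaving-edge {R = R} (step {v = w} p e) r∈ u∉ with w ∈? R
  ... | yes w∈ = w , _ , w∈ , u∉ , e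
  ... | no  w∉ = leaving-edge p r∈ w∉

  Within : (Fin n → Fin n → Set) → Subset n → Fin n → Fin n → Set
  Within E X a b = E a b × a ∈ X × b ∈ X

  walk-inside : {E : Fin n → Fin n → Set} → (∀ {a b} → E a b → E b a) →
    (X : Subset n) (v : Fin n) → (∀ {a b} → a ∈ X → b ∉ X → E a b → a ≡ v) →
    ∀ {u w} → u ∈ X → Reach E u w →
    (w ∈ X → Reach (Within E X) u w) × (w ∉ X → Reach (Within E X) u v)
  walk-inside esym X v attach u∈ here = (λ _ → here) , (λ u∉ → contradiction u∈ u∉)
  walk-inside {E} esym X v attach {u} u∈ (step {v = w′} {w = w} p e)
    with walk-inside esym X v attach u∈ p | w′ ∈? X | w ∈? X
  ... | ih , _ | yes w′∈ | yes w∈ = (λ _ → step (ih w′∈) (e , w′∈ , w∈)) , (λ w∉ → contradiction w∈ w∉)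
  ... | ih , _ | yes w′∈ | no w∉ =
    (λ w∈ → contradiction w∈ w∉) , (λ _ → subst (Reach (Within E X) u) (attach w′∈ w∉ e) (ih w′∈))
  ... | _ , ih | no w′∉ | yes w∈ =
    (λ _ → subst (Reach (Within E X) u) (≡-sym (attach w∈ w′∉ (esym e))) (ih w′∉)) ,
    (λ w∉ → contradiction w∈ w∉)
  ... | _ , ih | no w′∉ | no w∉ = (λ w∈ → contradiction w∈ w∉) , (λ _ → ih w′∉)

open Walks

module BoolRelations {n : ℕ} where

  boolRel : {R : Fin n → Fin n → Set} → (∀ u w → Dec (R u w)) → Fin n → Fin n → Bool
  boolRel R? u w = does (R? u w)

  decide⁻ : {A : Set} (a? : Dec A) → does a? ≡ true → A
  decide⁻ (yes a) _ = a

  boolRel⁻ : {R : Fin n → Fin n → Set} (R? : ∀ u w → Dec (R u w)) {u w : Fin n} →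
             EdgeRel (boolRel R?) u w → R u w
  boolRel⁻ R? {u} {w} = decide⁻ (R? u w)

  boolRel⁺ : {R : Fin n → Fin n → Set} (R? : ∀ u w → Dec (R u w)) {u w : Fin n} →
             R u w → EdgeRel (boolRel R?) u w
  boolRel⁺ R? {u} {w} = dec-true (R? u w)

  boolRel-sym : {R : Fin n → Fin n → Set} (R? : ∀ u w → Dec (R u w)) →
                (∀ {u w} → R u w → R w u) → ∀ u w → boolRel R? u w ≡ boolRel R? w u
  boolRel-sym R? rsym u w with R? u w | R? w u
  ... | yes _  | yes _  = refl
  ... | no  _  | no  _  = refl
  ... | yes r  | no ¬r′ = contradiction (rsym r) ¬r′
  ... | no ¬r  | yes r′ = contradiction (rsym r′) ¬r

open BoolRelations

module ListFacts {A : Set} where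

  linked-snoc : {R : A → A → Set} (l : List A) (a b : A) →
                Linked R (l ++ [ a ]) → R a b → Linked R ((l ++ [ a ]) ++ [ b ])
  linked-snoc []          a b _          r = r ∷ [-]
  linked-snoc (c ∷ [])    a b (r₁ ∷ _)   r = r₁ ∷ r ∷ [-]
  linked-snoc (c ∷ d ∷ l) a b (r₁ ∷ rs)  r = r₁ ∷ linked-snoc (d ∷ l) a b rs r

  linked-mono : {R R′ : A → A → Set} {P : A → Set} → (∀ {u w} → P u → P w → R u w → R′ u w) →
                ∀ {l} → All P l → Linked R l → Linked R′ l
  linked-mono f []             []       = []
  linked-mono f (_ ∷ [])       [-]      = [-]
  linked-mono f (pu ∷ pw ∷ ps) (r ∷ rs) = f pu pw r ∷ linked-mono f (pw ∷ ps) rs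

  linked-suffix : {R : A → A → Set} (pre : List A) {a : A} {post : List A} →
                  Linked R (pre ++ a ∷ post) → Linked R (a ∷ post)
  linked-suffix []          l       = l
  linked-suffix (x ∷ [])    (_ ∷ l) = l
  linked-suffix (x ∷ y ∷ p) (_ ∷ l) = linked-suffix (y ∷ p) l

  unique-suffix : (pre : List A) {post : List A} → Unique (pre ++ post) → Unique post
  unique-suffix []        u       = u
  unique-suffix (x ∷ pre) (_ ∷ u) = unique-suffix pre u

  unique-disjoint : (pre : List A) {post : List A} {x : A} →
                    Unique (pre ++ post) → x ∈ˡ pre → x ∈ˡ post → Empty
  unique-disjoint (y ∷ pre) (y∉ ∷ _) (here refl) x∈post =
    All.lookup (AllP.++⁻ʳ pre y∉) x∈post refl
  unique-disjoint (y ∷ pre) (_ ∷ u) (there x∈pre) x∈post = unique-disjoint pre u x∈pre x∈post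

open ListFacts

module Cycles {n : ℕ} where

  rotate : (T : Fin n → Fin n → Bool) (x y : Fin n) (ys : List (Fin n)) →
           IsCycle T (x ∷ y ∷ ys) → IsCycle T (y ∷ ys ++ [ x ])
  rotate T x y ys (len , ((x≢y ∷ x∉ys) ∷ y∉ys ∷ uniq) , (exy ∷ links)) =
    subst (2 ≤_) (≡-sym (trans (length-++ ys) (ℕ.+-comm (length ys) 1))) len ,
    (AllP.++⁺ y∉ys ((λ y≡x → x≢y (≡-sym y≡x)) ∷ []) ∷
      AllPairsP.++⁺ uniq ([] ∷ [])
        (All.map (λ x≢z → (λ z≡x → x≢z (≡-sym z≡x)) ∷ []) x∉ys)) ,
    linked-snoc (y ∷ ys) x y links exy

  leaf-on-no-cycle : (T : Fin n → Fin n → Bool) → (∀ u w → T u w ≡ T w u) →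
    (b a : Fin n) → (∀ w → T b w ≡ true → w ≡ a) → ∀ c → IsCycle T c → b ∈ˡ c → Empty
  leaf-on-no-cycle T tsym b a leaf = on-cycle
    where
    -- b at an arbitrary position: rotate until b is the second vertex;
    -- then its two neighbours on the cycle would both be a.
    at : ∀ x pre post → IsCycle T (x ∷ pre ++ b ∷ post) → Empty
    at x [] [] (s≤s () , _)
    at x [] (z ∷ post) (_ , ((_ ∷ x≢z ∷ _) ∷ _) , (exb ∷ ebz ∷ _)) =
      x≢z (trans (leaf x (trans (tsym b x) exb)) (≡-sym (leaf z ebz)))
    at x (y ∷ pre) post cyc =
      at y pre (post ++ [ x ])
        (subst (λ l → IsCycle T (y ∷ l)) (++-assoc pre (b ∷ post) [ x ])
          (rotate T x y (pre ++ b ∷ post) cyc))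

    on-cycle : ∀ c → IsCycle T c → b ∈ˡ c → Empty
    on-cycle (x ∷ [])     (() , _) _
    on-cycle (x ∷ y ∷ ys) cyc      (here refl) = at y ys [] (rotate T x y ys cyc)
    on-cycle (x ∷ xs)     cyc      (there m) with ∈-∃++ m
    ... | pre , post , refl = at x pre post cyc

  cycle-mono : (T T′ : Fin n → Fin n → Bool) (P : Fin n → Set) →
    (∀ {u w} → P u → P w → T u w ≡ true → T′ u w ≡ true) →
    ∀ c → All P c → IsCycle T c → IsCycle T′ c
  cycle-mono T T′ P T⊆T′ (x ∷ xs) ps (len , uniq , links) =
    len , uniq , linked-mono T⊆T′ (AllP.++⁺ ps (All.head ps ∷ [])) links

  empty-acyclic : ∀ c → ¬ IsCycle (λ (_ _ : Fin n) → false) c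
  empty-acyclic (x ∷ [])     (() , _)
  empty-acyclic (x ∷ y ∷ ys) (_ , _ , (() ∷ _))

open Cycles

module EdgeInsertion {n : ℕ} where

  WithEdge : Fin n → Fin n → (Fin n → Fin n → Bool) → Fin n → Fin n → Set
  WithEdge a b T u w = ((u ≡ a × w ≡ b) ⊎ (u ≡ b × w ≡ a)) ⊎ T u w ≡ true

  withEdge? : (a b : Fin n) (T : Fin n → Fin n → Bool) → ∀ u w → Dec (WithEdge a b T u w)
  withEdge? a b T u w = ((u ≟ a ×-dec w ≟ b) ⊎-dec (u ≟ b ×-dec w ≟ a)) ⊎-dec (T u w Bool.≟ true)

  withEdge : Fin n → Fin n → (Fin n → Fin n → Bool) → Fin n → Fin n → Bool
  withEdge a b T = boolRel (withEdge? a b T)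

  withEdge-sym : ∀ a b T → (∀ u w → T u w ≡ T w u) → ∀ u w → withEdge a b T u w ≡ withEdge a b T w u
  withEdge-sym a b T tsym = boolRel-sym (withEdge? a b T) flip
    where
    flip : ∀ {u w} → WithEdge a b T u w → WithEdge a b T w u
    flip (inj₁ (inj₁ (p , q))) = inj₁ (inj₂ (q , p))
    flip (inj₁ (inj₂ (p , q))) = inj₁ (inj₁ (q , p))
    flip {u} {w} (inj₂ t)      = inj₂ (trans (tsym w u) t)

  withEdge⁻ : ∀ a b T {u w} → withEdge a b T u w ≡ true → WithEdge a b T u w
  withEdge⁻ a b T = boolRel⁻ (withEdge? a b T)

  withEdge-old : ∀ a b T {u w} → T u w ≡ true → withEdge a b T u w ≡ true
  withEdge-old a b T e = boolRel⁺ (withEdge? a b T) (inj₂ e)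

  withEdge-new : ∀ a b T → withEdge a b T b a ≡ true
  withEdge-new a b T = boolRel⁺ (withEdge? a b T) (inj₁ (inj₂ (refl , refl)))

  -- Adding a pendant edge ab, where b is not yet touched by T, keeps T acyclic:
  -- a cycle through b is impossible as a is its only neighbour, and a cycle
  -- avoiding b is a cycle of T.
  pendant-acyclic : ∀ {a b T} → (∀ u w → T u w ≡ T w u) → a ≢ b → (∀ w → T b w ≢ true) →
    (∀ c → ¬ IsCycle T c) → ∀ c → ¬ IsCycle (withEdge a b T) c
  pendant-acyclic {a} {b} {T} tsym a≢b untouched acyclic c cyc with Any.any? (b ≟_) c
  ... | yes b∈c = leaf-on-no-cycle (withEdge a b T) (withEdge-sym a b T tsym) b a leaf c cyc b∈c
    where
    leaf : ∀ w → withEdge a b T b w ≡ true → w ≡ a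
    leaf w e with withEdge⁻ a b T e
    ... | inj₁ (inj₁ (b≡a , _)) = contradiction (≡-sym b≡a) a≢b
    ... | inj₁ (inj₂ (_ , w≡a)) = w≡a
    ... | inj₂ t                = contradiction t (untouched w)
  ... | no  b∉c = acyclic c (cycle-mono (withEdge a b T) T (b ≢_) away c (AllP.¬Any⇒All¬ c b∉c) cyc)
    where
    away : ∀ {u w} → b ≢ u → b ≢ w → withEdge a b T u w ≡ true → T u w ≡ true
    away b≢u b≢w e with withEdge⁻ a b T e
    ... | inj₁ (inj₁ (_ , refl)) = contradiction refl b≢w
    ... | inj₁ (inj₂ (refl , _)) = contradiction refl b≢u
    ... | inj₂ t                 = t

open EdgeInsertion

-- Growing a spanning tree of G[X] one leaf at a time.
module TreeGrowth {n : ℕ} (G : Graph n) (X : Subset n)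
  (E : Fin n → Fin n → Bool) (E⊆X : ∀ u w → E u w ≡ true → IAdj G X u w)
  (Esym : ∀ u w → E u w ≡ E w u)
  (T₀ : Fin n → Fin n → Bool) (R₀ : Subset n) (r₀ : Fin n) (r₀∈R₀ : r₀ ∈ R₀)
  (covered : ∀ u → u ∈ X → u ∈ R₀ ⊎ Reach (EdgeRel E) r₀ u) where

  FromT₀orE : (Fin n → Fin n → Bool) → Set
  FromT₀orE T = ∀ u w → T u w ≡ true → T₀ u w ≡ true ⊎ E u w ≡ true

  record Partial (R : Subset n) (T : Fin n → Fin n → Bool) : Set where
    field
      R⊆X     : R ⊆ X
      edges   : ∀ u w → T u w ≡ true → IAdj G R u w
      tsym    : ∀ u w → T u w ≡ T w u
      conn    : ∀ u w → u ∈ R → w ∈ R → Reach (EdgeRel T) u w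
      acyclic : ∀ c → ¬ IsCycle T c
      origin  : FromT₀orE T

  Result : Set
  Result = Σ (Fin n → Fin n → Bool) λ T → IsSpanningTree G X T × FromT₀orE T

  finish : ∀ {R T} → Partial R T → X ⊆ R → Result
  finish {R} {T} t X⊆R = T , record
    { sub     = λ u w e → let (a , p , q) = edges u w e in a , R⊆X p , R⊆X q
    ; tsym    = tsym
    ; conn    = λ u w p q → conn u w (X⊆R p) (X⊆R q)
    ; acyclic = acyclic } , origin
    where open Partial t

  extend : ∀ {R T} → Partial R T → ∀ a b → a ∈ R → b ∉ R → E a b ≡ true →
           Partial (R ∪ ⁅ b ⁆) (withEdge a b T)
  extend {R} {T} t a b a∈ b∉ eab = record
    { R⊆X     = R′⊆X
    ; edges   = edges′
    ; tsym    = withEdge-sym a b T tsym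
    ; conn    = λ u w p q → reach-trans (to-a p) (reach-sym esym (to-a q))
    ; acyclic = pendant-acyclic tsym (λ { refl → b∉ a∈ }) (λ w e → b∉ (proj₁ (proj₂ (edges b w e))))
                  acyclic
    ; origin  = origin′ }
    where
    open Partial t
    R′ : Subset n
    R′ = R ∪ ⁅ b ⁆
    esym : ∀ {u w} → EdgeRel (withEdge a b T) u w → EdgeRel (withEdge a b T) w u
    esym {u} {w} e = trans (withEdge-sym a b T tsym w u) e
    old∈ : ∀ {u} → u ∈ R → u ∈ R′
    old∈ m = x∈p∪q⁺ (inj₁ m)
    b∈ : b ∈ R′
    b∈ = x∈p∪q⁺ (inj₂ (x∈⁅x⁆ b))
    eab′ : IAdj G X a b
    eab′ = E⊆X a b eab
    R′⊆X : R′ ⊆ X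
    R′⊆X m with x∈p∪q⁻ R ⁅ b ⁆ m
    ... | inj₁ m′ = R⊆X m′
    ... | inj₂ m′ rewrite x∈⁅y⁆⇒x≡y b m′ = proj₂ (proj₂ eab′)
    edges′ : ∀ u w → withEdge a b T u w ≡ true → IAdj G R′ u w
    edges′ u w e with withEdge⁻ a b T e
    ... | inj₁ (inj₁ (refl , refl)) = proj₁ eab′ , old∈ a∈ , b∈
    ... | inj₁ (inj₂ (refl , refl)) = iadj-sym {G = G} (proj₁ eab′ , old∈ a∈ , b∈)
    ... | inj₂ t′ = let (x , p , q) = edges u w t′ in x , old∈ p , old∈ q
    to-a : ∀ {u} → u ∈ R′ → Reach (EdgeRel (withEdge a b T)) u a
    to-a {u} m with x∈p∪q⁻ R ⁅ b ⁆ m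
    ... | inj₁ m′ = reach-map (withEdge-old a b T) (conn u a m′ a∈)
    ... | inj₂ m′ rewrite x∈⁅y⁆⇒x≡y b m′ = step here (withEdge-new a b T)
    origin′ : FromT₀orE (withEdge a b T)
    origin′ u w e with withEdge⁻ a b T e
    ... | inj₁ (inj₁ (refl , refl)) = inj₂ eab
    ... | inj₁ (inj₂ (refl , refl)) = inj₂ (trans (Esym b a) eab)
    ... | inj₂ t′ = origin u w t′

  LeavingEdge : Subset n → Set
  LeavingEdge R = ∃[ a ] ∃[ b ] (a ∈ R × b ∉ R × E a b ≡ true)

  leaving? : ∀ R → Dec (LeavingEdge R)
  leaving? R = any? λ a → any? λ b →
    (a ∈? R) ×-dec (¬? (b ∈? R) ×-dec (E a b Bool.≟ true))

  saturated : {R : Subset n} → R₀ ⊆ R → ¬ LeavingEdge R → X ⊆ R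
  saturated {R} R₀⊆R none {u} u∈X with u ∈? R | covered u u∈X
  ... | yes u∈R | _         = u∈R
  ... | no  u∉R | inj₁ u∈R₀ = contradiction (R₀⊆R u∈R₀) u∉R
  ... | no  u∉R | inj₂ walk = contradiction (leaving-edge walk (R₀⊆R r₀∈R₀) u∉R) none

  insert-grows : {R : Subset n} {b : Fin n} → b ∉ R → ∣ R ∣ < ∣ R ∪ ⁅ b ⁆ ∣
  insert-grows {R} {b} b∉ = p⊂q⇒∣p∣<∣q∣ (p⊆p∪q ⁅ b ⁆ , b , q⊆p∪q R ⁅ b ⁆ (x∈⁅x⁆ b) , b∉)

  -- Each extension adds a vertex, so n extensions suffice (k is the remaining fuel).
  grow : ∀ k {R : Subset n} {T : Fin n → Fin n → Bool} → n ≤ ∣ R ∣ + k → R₀ ⊆ R → Partial R T → Result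
  grow k {R} fuel R₀⊆R t with leaving? R
  ... | no none = finish t (saturated R₀⊆R none)
  ... | yes (a , b , a∈ , b∉ , e) with k
  ...   | zero = contradiction (ℕ.≤-trans fuel (ℕ.≤-reflexive (ℕ.+-identityʳ _)))
                   (ℕ.<⇒≱ (ℕ.<-≤-trans (insert-grows b∉) (∣p∣≤n (R ∪ ⁅ b ⁆))))
  ...   | suc k′ = grow k′ fuel′ (λ m → p⊆p∪q ⁅ b ⁆ (R₀⊆R m)) (extend t a b a∈ b∉ e)
    where
    fuel′ : n ≤ ∣ R ∪ ⁅ b ⁆ ∣ + k′
    fuel′ = ℕ.≤-trans fuel
      (ℕ.≤-trans (ℕ.≤-reflexive (ℕ.+-suc ∣ R ∣ k′)) (ℕ.+-monoˡ-≤ k′ (insert-grows b∉)))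

  grow-tree : ∀ {T} → Partial R₀ T → Result
  grow-tree = grow n (ℕ.m≤n+m n ∣ R₀ ∣) (λ m → m)

module SpanningTrees {n : ℕ} (G : Graph n) where

  within? : (T : Fin n → Fin n → Bool) (X : Subset n) → ∀ u w → Dec (Within (EdgeRel T) X u w)
  within? T X u w = (T u w Bool.≟ true) ×-dec ((u ∈? X) ×-dec (w ∈? X))

  restrict : (Fin n → Fin n → Bool) → Subset n → Fin n → Fin n → Bool
  restrict T X = boolRel (within? T X)

  restrict⊆ : ∀ T X {u w} → restrict T X u w ≡ true → T u w ≡ true
  restrict⊆ T X e = proj₁ (boolRel⁻ (within? T X) e)

  spanning-tree : (X : Subset n) (v : Fin n) → v ∈ X → (∀ u → u ∈ X → Reach (IAdj G X) v u) →
                  Σ (Fin n → Fin n → Bool) (IsSpanningTree G X)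
  spanning-tree X v v∈X reach = let (T , tree , _) = grow-tree start in T , tree
    where
    IAdj? : ∀ u w → Dec (IAdj G X u w)
    IAdj? = within? (adj G) X
    open TreeGrowth G X (restrict (adj G) X) (λ u w → boolRel⁻ IAdj?) (boolRel-sym IAdj? (iadj-sym {G = G}))
      (λ _ _ → false) ⁅ v ⁆ v (x∈⁅x⁆ v) (λ u u∈X → inj₂ (reach-map (boolRel⁺ IAdj?) (reach u u∈X)))
    start : Partial ⁅ v ⁆ (λ _ _ → false)
    start = record
      { R⊆X     = λ m → subst (_∈ X) (≡-sym (x∈⁅y⁆⇒x≡y v m)) v∈X
      ; edges   = λ u w ()
      ; tsym    = λ u w → refl
      ; conn    = λ u w p q → subst₂ (Reach _) (≡-sym (x∈⁅y⁆⇒x≡y v p)) (≡-sym (x∈⁅y⁆⇒x≡y v q)) here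
      ; acyclic = empty-acyclic
      ; origin  = λ u w () }

  glue-trees : (B C : Subset n) (v : Fin n) → v ∈ B → v ∈ C → (∀ u → u ∉ B → u ∈ C) →
    ∀ T₁ T₂ → IsSpanningTree G B T₁ → IsSpanningTree G C T₂ →
    Σ (Fin n → Fin n → Bool) λ T →
      IsSpanningTree G ⊤ T × (∀ u w → T u w ≡ true → T₁ u w ≡ true ⊎ T₂ u w ≡ true)
  glue-trees B C v v∈B v∈C B∪C T₁ T₂ tree₁ tree₂ = grow-tree start
    where
    module T₁ = IsSpanningTree tree₁
    module T₂ = IsSpanningTree tree₂
    covered : ∀ u → u ∈ ⊤ → u ∈ B ⊎ Reach (EdgeRel T₂) v u
    covered u _ with u ∈? B
    ... | yes u∈B = inj₁ u∈B
    ... | no  u∉B = inj₂ (T₂.conn v u v∈C (B∪C u u∉B))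
    open TreeGrowth G ⊤ T₂ (λ u w e → proj₁ (T₂.sub u w e) , ∈⊤ , ∈⊤) T₂.tsym T₁ B v v∈B covered
    start : Partial B T₁
    start = record
      { R⊆X = λ _ → ∈⊤ ; edges = T₁.sub ; tsym = T₁.tsym ; conn = T₁.conn
      ; acyclic = T₁.acyclic ; origin = λ u w e → inj₁ e }

  restrict-tree : (X : Subset n) (v : Fin n) → (∀ {a b} → a ∈ X → b ∉ X → adj G a b ≡ true → a ≡ v) →
    ∀ T → IsSpanningTree G ⊤ T → IsSpanningTree G X (restrict T X)
  restrict-tree X v attach T tree = record
    { sub     = λ u w e → let (t , p , q) = boolRel⁻ (within? T X) e in proj₁ (sub u w t) , p , q
    ; tsym    = boolRel-sym (within? T X) within-sym
    ; conn    = λ u w p q → reach-map (boolRel⁺ (within? T X))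
                  (proj₁ (walk-inside esym X v attach′ p (conn u w ∈⊤ ∈⊤)) q)
    ; acyclic = λ c cyc → acyclic c
                  (cycle-mono (restrict T X) T _ (λ _ _ → restrict⊆ T X) c (All.universal-U c) cyc) }
    where
    open IsSpanningTree tree
    esym : ∀ {a b} → EdgeRel T a b → EdgeRel T b a
    esym {a} {b} e = trans (tsym b a) e
    within-sym : ∀ {a b} → Within (EdgeRel T) X a b → Within (EdgeRel T) X b a
    within-sym (e , p , q) = esym e , q , p
    attach′ : ∀ {a b} → a ∈ X → b ∉ X → EdgeRel T a b → a ≡ v
    attach′ {a} {b} p q e = attach p q (proj₁ (sub a b e))

module Removal {m : ℕ} where

  ∈-remove⁻ : {x y : Fin m} (p : Subset m) → x ∈ p - y → x ∈ p × x ≢ y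
  ∈-remove⁻ {x} {y} p x∈ = p─q⊆p p ⁅ y ⁆ x∈ , λ { refl → ∈─⇒∉ p ⁅ x ⁆ x∈ (x∈⁅x⁆ x) }
    where
    ∈─⇒∉ : ∀ {k} {z : Fin k} (p q : Subset k) → z ∈ p ─ q → z ∉ q
    ∈─⇒∉ (inside ∷ p) (outside ∷ q) here      ()
    ∈─⇒∉ (s ∷ p)      (t ∷ q)       (there m) (there m′) = ∈─⇒∉ p q m m′

open Removal

module Paths {n : ℕ} where

  -- first a pre is the first vertex of pre ++ a ∷ _.
  first : Fin n → List (Fin n) → Fin n
  first a []      = a
  first a (z ∷ _) = z

  final : Fin n → List (Fin n) → Fin n
  final a []       = a
  final a (z ∷ zs) = final z zs

  final-++ : ∀ d pre a post → final d (pre ++ a ∷ post) ≡ final a post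
  final-++ d []        a post = refl
  final-++ d (z ∷ pre) a post = final-++ z pre a post

  final∈ : ∀ a post → final a post ∈ˡ a ∷ post
  final∈ a []         = here refl
  final∈ a (z ∷ post) = there (final∈ z post)

  first-++ : ∀ {v rest} pre {a post} → v ∷ rest ≡ pre ++ a ∷ post → first a pre ≡ v
  first-++ []        refl = refl
  first-++ (z ∷ pre) refl = refl

  first∉ : ∀ {a c} pre → ¬ (c ∈ˡ pre) → a ≢ c → first a pre ≢ c
  first∉ []      _   a≢c = a≢c
  first∉ (z ∷ _) c∉ _  refl = c∉ (here refl)

  vertices : List (Fin n) → Subset n
  vertices []       = ⊥
  vertices (z ∷ zs) = ⁅ z ⁆ ∪ vertices zs

  vertices⁺ : ∀ {z} l → z ∈ˡ l → z ∈ vertices l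
  vertices⁺ (x ∷ l) (here refl) = x∈p∪q⁺ (inj₁ (x∈⁅x⁆ x))
  vertices⁺ (x ∷ l) (there m)   = x∈p∪q⁺ (inj₂ (vertices⁺ l m))

  vertices⁻ : ∀ {z} l → z ∈ vertices l → z ∈ˡ l
  vertices⁻ []      m = contradiction m ∉⊥
  vertices⁻ (x ∷ l) m with x∈p∪q⁻ ⁅ x ⁆ (vertices l) m
  ... | inj₁ m′ = here (x∈⁅y⁆⇒x≡y x m′)
  ... | inj₂ m′ = there (vertices⁻ l m′)

  module _ (G : Graph n) (Z : Subset n) where

    walk-forward : ∀ a post → Linked (EdgeRel (adj G)) (a ∷ post) → All (_∈ Z) (a ∷ post) →
                   Reach (IAdj G Z) a (final a post)
    walk-forward a []         _        _               = here
    walk-forward a (b ∷ post) (e ∷ lk) (a∈ ∷ b∈ ∷ ps) =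
      reach-trans (step here (e , a∈ , b∈)) (walk-forward b post lk (b∈ ∷ ps))

    walk-backward : ∀ pre {a post} → Linked (EdgeRel (adj G)) (pre ++ a ∷ post) →
                    All (_∈ Z) pre → a ∈ Z → Reach (IAdj G Z) a (first a pre)
    walk-backward []                  _        _             _  = here
    walk-backward (p ∷ [])    {a}     (e ∷ _)  (p∈ ∷ _)      a∈ =
      step here (iadj-sym {G = G} (e , p∈ , a∈))
    walk-backward (p ∷ q ∷ pre)       (e ∷ lk) (p∈ ∷ q∈ ∷ ps) a∈ =
      step (walk-backward (q ∷ pre) lk (q∈ ∷ ps) a∈) (iadj-sym {G = G} (e , p∈ , q∈))

open Paths

-- Let B be a block of the connected graph G whose only cut vertex
-- of G is v.  Then every edge from B to the rest of G starts at v: otherwise, for an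
-- edge xy with x ∈ B ∖ {v}, y ∉ B, the vertex y reaches v in G - x (x is no cut
-- vertex), and B together with such a path from v to y is 2-connected, contradicting
-- the maximality of B.
module BlockBoundary {n : ℕ} (G : Graph n) (B : Subset n) (v : Fin n)
  (connected : Connected G ⊤) (block : IsBlock G B) (v∈B : v ∈ B)
  (only-cut : ∀ u → u ∈ B → CutVertex G ⊤ u → u ≡ v) where

  Adj : Fin n → Fin n → Set
  Adj = EdgeRel (adj G)

  B-connected : Connected G B
  B-connected = proj₁ (proj₁ block)

  -- Deleting one vertex c does not disconnect the remaining vertices of B (stated
  -- double-negated, since not being a cut vertex is a negative statement).
  B-minus-connected : ∀ c {b₁ b₂} → b₁ ∈ B → b₂ ∈ B → b₁ ≢ c → b₂ ≢ c →
                      ¬ ¬ Reach (IAdj G (B - c)) b₁ b₂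
  B-minus-connected c {b₁} {b₂} p q p≢c q≢c with c ∈? B
  ... | yes c∈B = λ no-walk →
    proj₂ (proj₁ block) c (c∈B , b₁ , b₂ , p , q , p≢c , q≢c , B-connected b₁ b₂ p q , no-walk)
  ... | no  c∉B = λ no-walk → no-walk (reach-map keep (B-connected b₁ b₂ p q))
    where
    keep : ∀ {a b} → IAdj G B a b → IAdj G (B - c) a b
    keep (e , a∈ , b∈) =
      e , x∈p∧x≢y⇒x∈p-y a∈ (λ { refl → c∉B a∈ }) , x∈p∧x≢y⇒x∈p-y b∈ (λ { refl → c∉B b∈ })

  module _ (x y : Fin n) (x∈B : x ∈ B) (x≢v : x ≢ v) (y∉B : y ∉ B) (exy : Adj x y) where

    record PathToY (w : Fin n) : Set where
      field
        rest  : List (Fin n)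
        uniq  : Unique (w ∷ rest)
        links : Linked Adj (w ∷ rest)
        avoid : All (_≢ x) (w ∷ rest)
        ends  : final w rest ≡ y

    loop-erase : ∀ {w} → Reach (IAdj G (⊤ - x)) y w → PathToY w
    loop-erase here = record
      { rest = [] ; uniq = [] ∷ [] ; links = [-] ; avoid = (λ { refl → y∉B x∈B }) ∷ [] ; ends = refl }
    loop-erase (step {v = w} {w = w′} p e) with loop-erase p
    ... | P with Any.any? (w′ ≟_) (w ∷ PathToY.rest P)
    ...   | no w′∉P = record
      { rest  = w ∷ rest
      ; uniq  = AllP.¬Any⇒All¬ _ w′∉P ∷ uniq
      ; links = trans (Graph.sym G w′ w) (proj₁ e) ∷ links
      ; avoid = proj₂ (∈-remove⁻ ⊤ (proj₂ (proj₂ e))) ∷ avoid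
      ; ends  = ends }
      where open PathToY P
    ...   | yes w′∈P with ∈-∃++ w′∈P
    ...     | pre , post , split = record
      { rest  = post
      ; uniq  = unique-suffix pre (subst Unique split uniq)
      ; links = linked-suffix pre (subst (Linked Adj) split links)
      ; avoid = AllP.++⁻ʳ pre (subst (All (_≢ x)) split avoid)
      ; ends  = trans (≡-sym (final-++ w′ pre w′ post)) (trans (cong (final w′) (≡-sym split)) ends) }
      where open PathToY P

    -- B together with a path from v to y would be 2-connected.
    module Ear (P : PathToY v) where
      open PathToY P

      L : List (Fin n)
      L = v ∷ rest

      Y : Subset n
      Y = B ∪ vertices L

      B⊆Y : B ⊆ Y
      B⊆Y m = x∈p∪q⁺ (inj₁ m)

      L⊆Y : ∀ {z} → z ∈ˡ L → z ∈ Y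
      L⊆Y m = x∈p∪q⁺ (inj₂ (vertices⁺ L m))

      Y⁻ : ∀ {z} → z ∈ Y → z ∈ B ⊎ z ∈ˡ L
      Y⁻ m with x∈p∪q⁻ B (vertices L) m
      ... | inj₁ m′ = inj₁ m′
      ... | inj₂ m′ = inj₂ (vertices⁻ L m′)

      to-v : ∀ {a} → a ∈ Y → Reach (IAdj G Y) a v
      to-v {a} a∈ with Y⁻ a∈
      ... | inj₁ a∈B = reach-map (λ (e , p , q) → e , B⊆Y p , B⊆Y q) (B-connected a v a∈B v∈B)
      ... | inj₂ a∈L with ∈-∃++ a∈L
      ...   | pre , post , split = subst (Reach (IAdj G Y) a) (first-++ pre split)
        (walk-backward G Y pre (subst (Linked Adj) split links)
          (All.tabulate (λ z∈ → L⊆Y (subst (_ ∈ˡ_) (≡-sym split) (AnyP.++⁺ˡ z∈)))) a∈)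

      Y-connected : Connected G Y
      Y-connected u w p q = reach-trans (to-v p) (reach-sym (iadj-sym {G = G}) (to-v q))

      anchor : ∀ c {a} → a ∈ Y → a ≢ c → ∃[ b ] (b ∈ B × b ≢ c × Reach (IAdj G (Y - c)) a b)
      anchor c {a} a∈ a≢c with Y⁻ a∈
      ... | inj₁ a∈B = a , a∈B , a≢c , here
      ... | inj₂ a∈L with ∈-∃++ a∈L
      ...   | pre , post , split with Any.any? (c ≟_) pre
      ...     | yes c∈pre =
        x , x∈B , x≢c , step to-y (iadj-sym {G = G} (exy , in-Y-c (B⊆Y x∈B) x≢c , y∈))
        where
        -- c lies before a, so the part of the path from a to y avoids c.
        in-Y-c : ∀ {z} → z ∈ Y → z ≢ c → z ∈ Y - c
        in-Y-c = x∈p∧x≢y⇒x∈p-y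
        c∉suffix : c ∈ˡ a ∷ post → Empty
        c∉suffix = unique-disjoint pre (subst Unique split uniq) c∈pre
        x≢c : x ≢ c
        x≢c refl = All.lookup avoid (subst (_ ∈ˡ_) (≡-sym split) (AnyP.++⁺ˡ c∈pre)) refl
        suffix∈ : All (_∈ Y - c) (a ∷ post)
        suffix∈ = All.tabulate λ z∈ →
          in-Y-c (L⊆Y (subst (_ ∈ˡ_) (≡-sym split) (AnyP.++⁺ʳ pre z∈))) (λ { refl → c∉suffix z∈ })
        end : final a post ≡ y
        end = trans (≡-sym (final-++ v pre a post)) (trans (cong (final v) (≡-sym split)) ends)
        to-y : Reach (IAdj G (Y - c)) a y
        to-y = subst (Reach (IAdj G (Y - c)) a) end
          (walk-forward G (Y - c) a post (linked-suffix pre (subst (Linked Adj) split links)) suffix∈)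
        y∈ : y ∈ Y - c
        y∈ = subst (_∈ Y - c) end (All.lookup suffix∈ (final∈ a post))
      ...     | no c∉pre = first a pre , subst (_∈ B) (≡-sym (first-++ pre split)) v∈B ,
        first∉ pre c∉pre a≢c ,
        walk-backward G (Y - c) pre (subst (Linked Adj) split links)
          (All.tabulate λ {z} z∈ → x∈p∧x≢y⇒x∈p-y (L⊆Y (subst (z ∈ˡ_) (≡-sym split) (AnyP.++⁺ˡ z∈)))
                                                (λ { refl → c∉pre z∈ }))
          (x∈p∧x≢y⇒x∈p-y a∈ a≢c)

      no-cut-vertex : ∀ c → ¬ CutVertex G Y c
      no-cut-vertex c (_ , u , w , u∈ , w∈ , u≢c , w≢c , _ , no-walk)
        with anchor c u∈ u≢c | anchor c w∈ w≢c
      ... | b₁ , b₁∈ , b₁≢c , u→b₁ | b₂ , b₂∈ , b₂≢c , w→b₂ =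
        B-minus-connected c b₁∈ b₂∈ b₁≢c b₂≢c λ b₁→b₂ →
          no-walk (reach-trans u→b₁
            (reach-trans (reach-map widen b₁→b₂) (reach-sym (iadj-sym {G = G}) w→b₂)))
        where
        widen : ∀ {a b} → IAdj G (B - c) a b → IAdj G (Y - c) a b
        widen (e , p , q) = e , grow p , grow q
          where
          grow : ∀ {z} → z ∈ B - c → z ∈ Y - c
          grow m = let (z∈B , z≢c) = ∈-remove⁻ B m in x∈p∧x≢y⇒x∈p-y (B⊆Y z∈B) z≢c

      impossible : Empty
      impossible = y∉B (proj₂ block Y B⊆Y (Y-connected , no-cut-vertex)
                               (L⊆Y (subst (_∈ˡ L) ends (final∈ v rest))))

    -- y reaches v avoiding x since x is no cut vertex of G.
    no-such-edge : Empty
    no-such-edge = x-not-cut λ walk → Ear.impossible (loop-erase walk)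
      where
      x-not-cut : ¬ ¬ Reach (IAdj G (⊤ - x)) y v
      x-not-cut no-walk = x≢v (only-cut x x∈B
        (∈⊤ , y , v , ∈⊤ , ∈⊤ , (λ { refl → y∉B x∈B }) , (λ { refl → x≢v refl }) ,
         connected y v ∈⊤ ∈⊤ , no-walk))

  leaves-from-v : ∀ {a b} → a ∈ B → b ∉ B → adj G a b ≡ true → a ≡ v
  leaves-from-v {a} {b} a∈ b∉ e with a ≟ v
  ... | yes a≡v = a≡v
  ... | no  a≢v = ⊥-elim (no-such-edge a b a∈ a≢v b∉ e)

attached-connected : {n : ℕ} (G : Graph n) (X : Subset n) (v : Fin n) → Connected G ⊤ → v ∈ X →
  (∀ {a b} → a ∈ X → b ∉ X → adj G a b ≡ true → a ≡ v) →
  ∀ u → u ∈ X → Reach (IAdj G X) v u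
attached-connected G X v connected v∈X attach u u∈X =
  proj₁ (walk-inside (λ {a} {b} e → trans (Graph.sym G b a) e) X v attach v∈X
          (reach-map proj₁ (connected v u ∈⊤ ∈⊤))) u∈X

record Separation {n : ℕ} (G : Graph n) (v : Fin n) (X Y : Subset n) : Set where
  field
    v∈X    : v ∈ X
    v∈Y    : v ∈ Y
    cover  : ∀ {u} → u ∉ X → u ∈ Y
    meet   : ∀ {u} → u ∈ X → u ∈ Y → u ≡ v
    attach : ∀ {a b} → a ∈ X → b ∉ X → adj G a b ≡ true → a ≡ v

  attachʸ : ∀ {a b} → a ∈ Y → b ∉ Y → adj G a b ≡ true → a ≡ v
  attachʸ {a} {b} a∈Y b∉Y e with a ∈? X | b ∈? X
  ... | yes a∈X | _       = meet a∈X a∈Y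
  ... | no  _   | no  b∉X = contradiction (cover b∉X) b∉Y
  ... | no  a∉X | yes b∈X =
    contradiction (subst (_∈ Y) (≡-sym (attach b∈X a∉X (trans (Graph.sym G b a) e))) v∈Y) b∉Y

  coverʸ : ∀ {u} → u ∉ Y → u ∈ X
  coverʸ {u} u∉Y with u ∈? X
  ... | yes u∈X = u∈X
  ... | no  u∉X = contradiction (cover u∉X) u∉Y

swap : {n : ℕ} {G : Graph n} {v : Fin n} {X Y : Subset n} → Separation G v X Y → Separation G v Y X
swap sep = record
  { v∈X = v∈Y ; v∈Y = v∈X ; cover = coverʸ ; meet = λ p q → meet q p ; attach = attachʸ }
  where open Separation sep

TreeDominated : {n : ℕ} → (Fin n → Fin n → Bool) → Subset n → Fin n → Set
TreeDominated T S w = w ∈ S ⊎ ∃[ u ] (T w u ≡ true × u ∈ S)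

tree-dominated? : {n : ℕ} (T : Fin n → Fin n → Bool) (S : Subset n) (w : Fin n) →
                  Dec (TreeDominated T S w)
tree-dominated? T S w = (w ∈? S) ⊎-dec any? (λ u → (T w u Bool.≟ true) ×-dec (u ∈? S))

module OneSide {n : ℕ} {G : Graph n} {v : Fin n} {X Y : Subset n}
  (connected : Connected G ⊤) (sep : Separation G v X Y) where
  open Separation sep
  open SpanningTrees G

  ends-in : ∀ {Z T u w} → IsSpanningTree G Z T → T u w ≡ true → u ∈ Z × w ∈ Z
  ends-in {u = u} {w} tree e = proj₂ (IsSpanningTree.sub tree u w e)

  tree-Y : Σ (Fin n → Fin n → Bool) (IsSpanningTree G Y)
  tree-Y = spanning-tree Y v v∈Y (attached-connected G Y v connected v∈Y attachʸ)

  -- Being dominated in G[X] implies being dominated in G, since every spanning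
  -- tree of G restricts to one of G[X].
  dominated-up : ∀ {S S′ u} → S ⊆ S′ → SimDominated G X S u → SimDominated G ⊤ S′ u
  dominated-up S⊆S′ dom T tree with dom (restrict T X) (restrict-tree X v attach T tree)
  ... | inj₁ u∈S           = inj₁ (S⊆S′ u∈S)
  ... | inj₂ (w , e , w∈S) = inj₂ (w , restrict⊆ T X e , S⊆S′ w∈S)

  -- A vertex of X other than v dominated in G is dominated in G[X]: glue any
  -- spanning tree of G[X] with a fixed one of G[Y]; the neighbours of u in the
  -- glued tree all come from the G[X] part.
  dominated-down : ∀ {S u} → u ∈ X → u ≢ v → SimDominated G ⊤ S u → SimDominated G X (S ∩ X) u
  dominated-down {S} {u} u∈X u≢v dom T₁ tree₁
    with glue-trees X Y v v∈X v∈Y (λ _ → cover) T₁ (proj₁ tree-Y) tree₁ (proj₂ tree-Y)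
  ... | T , tree , T⊆ with dom T tree
  ...   | inj₁ u∈S = inj₁ (x∈p∩q⁺ (u∈S , u∈X))
  ...   | inj₂ (w , e , w∈S) with T⊆ u w e
  ...     | inj₁ e₁ = inj₂ (w , e₁ , x∈p∩q⁺ (w∈S , proj₂ (ends-in tree₁ e₁)))
  ...     | inj₂ e₂ = contradiction (meet u∈X (proj₁ (ends-in (proj₂ tree-Y) e₂))) u≢v

  dominated-v : ∀ {S} → SimDominated G ⊤ S v →
    ¬ ¬ (SimDominated G X (S ∩ X) v ⊎ SimDominated G Y (S ∩ Y) v)
  dominated-v {S} dom neither = neither (inj₁ in-X)
    where
    in-X : SimDominated G X (S ∩ X) v
    in-X T₁ tree₁ with tree-dominated? T₁ (S ∩ X) v
    ... | yes d₁ = d₁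
    ... | no ¬d₁ = ⊥-elim (neither (inj₂ in-Y))
      where
      in-Y : SimDominated G Y (S ∩ Y) v
      in-Y T₂ tree₂ with tree-dominated? T₂ (S ∩ Y) v
      ... | yes d₂ = d₂
      ... | no ¬d₂ with glue-trees X Y v v∈X v∈Y (λ _ → cover) T₁ T₂ tree₁ tree₂
      ...   | T , tree , T⊆ with dom T tree
      ...     | inj₁ v∈S = ⊥-elim (¬d₁ (inj₁ (x∈p∩q⁺ (v∈S , v∈X))))
      ...     | inj₂ (w , e , w∈S) with T⊆ v w e
      ...       | inj₁ e₁ = ⊥-elim (¬d₁ (inj₂ (w , e₁ , x∈p∩q⁺ (w∈S , proj₂ (ends-in tree₁ e₁)))))
      ...       | inj₂ e₂ = ⊥-elim (¬d₂ (inj₂ (w , e₂ , x∈p∩q⁺ (w∈S , proj₂ (ends-in tree₂ e₂)))))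

module Counting where

  ∣p∪q∣+∣p∩q∣≡∣p∣+∣q∣ : ∀ {m} (p q : Subset m) → ∣ p ∪ q ∣ + ∣ p ∩ q ∣ ≡ ∣ p ∣ + ∣ q ∣
  ∣p∪q∣+∣p∩q∣≡∣p∣+∣q∣ []            []            = refl
  ∣p∪q∣+∣p∩q∣≡∣p∣+∣q∣ (inside ∷ p)  (inside ∷ q)  =
    cong suc (trans (ℕ.+-suc _ _) (trans (cong suc (∣p∪q∣+∣p∩q∣≡∣p∣+∣q∣ p q)) (≡-sym (ℕ.+-suc _ _))))
  ∣p∪q∣+∣p∩q∣≡∣p∣+∣q∣ (inside ∷ p)  (outside ∷ q) = cong suc (∣p∪q∣+∣p∩q∣≡∣p∣+∣q∣ p q)
  ∣p∪q∣+∣p∩q∣≡∣p∣+∣q∣ (outside ∷ p) (inside ∷ q)  =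
    trans (cong suc (∣p∪q∣+∣p∩q∣≡∣p∣+∣q∣ p q)) (≡-sym (ℕ.+-suc _ _))
  ∣p∪q∣+∣p∩q∣≡∣p∣+∣q∣ (outside ∷ p) (outside ∷ q) = ∣p∪q∣+∣p∩q∣≡∣p∣+∣q∣ p q

  ∣p∪q∣≤∣p∣+∣q∣ : ∀ {m} (p q : Subset m) → ∣ p ∪ q ∣ ≤ ∣ p ∣ + ∣ q ∣
  ∣p∪q∣≤∣p∣+∣q∣ p q = ℕ.≤-trans (ℕ.m≤m+n _ _) (ℕ.≤-reflexive (∣p∪q∣+∣p∩q∣≡∣p∣+∣q∣ p q))

  -- A common element is counted twice.
  shared-element : ∀ {m} {x : Fin m} (p q : Subset m) → x ∈ p → x ∈ q → suc ∣ p ∪ q ∣ ≤ ∣ p ∣ + ∣ q ∣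
  shared-element {x = x} p q x∈p x∈q = ℕ.≤-trans (ℕ.≤-reflexive (ℕ.+-comm 1 _))
    (ℕ.≤-trans (ℕ.+-monoʳ-≤ ∣ p ∪ q ∣ one) (ℕ.≤-reflexive (∣p∪q∣+∣p∩q∣≡∣p∣+∣q∣ p q)))
    where
    one : 1 ≤ ∣ p ∩ q ∣
    one = subst (_≤ ∣ p ∩ q ∣) (∣⁅x⁆∣≡1 x)
      (p⊆q⇒∣p∣≤∣q∣ λ m → subst (_∈ p ∩ q) (≡-sym (x∈⁅y⁆⇒x≡y x m)) (x∈p∩q⁺ (x∈p , x∈q)))

  overlap-bound : ∀ {m} (p q s d : Subset m) → p ∪ q ⊆ s → p ∩ q ⊆ d → ∣ p ∣ + ∣ q ∣ ≤ ∣ s ∣ + ∣ d ∣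
  overlap-bound p q s d p∪q⊆s p∩q⊆d = ℕ.≤-trans (ℕ.≤-reflexive (≡-sym (∣p∪q∣+∣p∩q∣≡∣p∣+∣q∣ p q)))
    (ℕ.+-mono-≤ (p⊆q⇒∣p∣≤∣q∣ p∪q⊆s) (p⊆q⇒∣p∣≤∣q∣ p∩q⊆d))

open Counting

module Recolouring {n : ℕ} (f : Fin n → Colour) (v : Fin n) where

  recolour-at : ∀ i → recolour f v i v ≡ i
  recolour-at i with v ≟ v
  ... | yes _   = refl
  ... | no  v≢v = contradiction refl v≢v

  recolour-away : ∀ i {u} → u ≢ v → recolour f v i u ≡ f u
  recolour-away i {u} u≢v with u ≟ v
  ... | yes u≡v = contradiction u≡v u≢v
  ... | no  _   = refl

  at-colour : ∀ j c (P : Fin n → Set) u → (j ≡ c → P v) → (u ≢ v → f u ≡ c → P u) →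
              recolour f v j u ≡ c → P u
  at-colour j c P u at-v away e = by-cases (u ≟ v)
    where
    by-cases : Dec (u ≡ v) → P u
    by-cases (yes u≡v) = subst P (≡-sym u≡v)
      (at-v (trans (≡-sym (recolour-at j)) (subst (λ w → recolour f v j w ≡ c) u≡v e)))
    by-cases (no u≢v)  = away u≢v (trans (≡-sym (recolour-away j u≢v)) e)

open Recolouring

sim-dominated-mono : {n : ℕ} {G : Graph n} {X S S′ : Subset n} {u : Fin n} →
  S ⊆ S′ → SimDominated G X S u → SimDominated G X S′ u
sim-dominated-mono S⊆S′ dom T tree with dom T tree
... | inj₁ u∈S           = inj₁ (S⊆S′ u∈S)
... | inj₂ (w , e , w∈S) = inj₂ (w , e , S⊆S′ w∈S)

respecting-recolour : {n : ℕ} (G : Graph n) (X : Subset n) (f : Fin n → Colour) (v : Fin n) →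
  ∀ i j {S S′} → Respecting G X (recolour f v i) S → S ⊆ S′ → S′ ⊆ X →
  (j ≡ c1 → v ∈ S′) → (j ≡ c0̂ → SimDominated G X S′ v) → Respecting G X (recolour f v j) S′
respecting-recolour G X f v i j {S′ = S′} (_ , ones , hats) S⊆S′ S′⊆X at-v₁ at-v₀̂ =
  S′⊆X ,
  (λ u u∈X → at-colour f v j c1 (_∈ S′) u at-v₁ λ u≢v e →
     S⊆S′ (ones u u∈X (trans (recolour-away f v i u≢v) e))) ,
  (λ u u∈X → at-colour f v j c0̂ (SimDominated G X S′) u at-v₀̂ λ u≢v e →
     sim-dominated-mono S⊆S′ (hats u u∈X (trans (recolour-away f v i u≢v) e)))

module ColourBounds {n : ℕ} (G : Graph n) (X : Subset n) (f : Fin n → Colour) (v : Fin n) (v∈X : v ∈ X)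
  (S : Colour → Subset n) (min : ∀ i → MinRespecting G X (recolour f v i) (S i)) where

  respecting : ∀ i → Respecting G X (recolour f v i) (S i)
  respecting i = proj₁ (min i)

  v∈S₁ : v ∈ S c1
  v∈S₁ = proj₁ (proj₂ (respecting c1)) v v∈X (recolour-at f v c1)

  ∣S₀∣≤∣S₀̂∣ : ∣ S c0 ∣ ≤ ∣ S c0̂ ∣
  ∣S₀∣≤∣S₀̂∣ = proj₂ (min c0) (S c0̂)
    (respecting-recolour G X f v c0̂ c0 (respecting c0̂) (λ m → m) (proj₁ (respecting c0̂))
      (λ ()) (λ ()))

  ∣S₀̂∣≤∣S₁∣ : ∣ S c0̂ ∣ ≤ ∣ S c1 ∣
  ∣S₀̂∣≤∣S₁∣ = proj₂ (min c0̂) (S c1)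
    (respecting-recolour G X f v c1 c0̂ (respecting c1) (λ m → m) (proj₁ (respecting c1)) (λ ())
      (λ _ _ _ → inj₁ v∈S₁))

  -- Adding v to a set for colour 0 gives one for colour 1.
  ∣S₁∣≤1+∣S₀∣ : ∣ S c1 ∣ ≤ suc ∣ S c0 ∣
  ∣S₁∣≤1+∣S₀∣ = ℕ.≤-trans (proj₂ (min c1) (S c0 ∪ ⁅ v ⁆)
      (respecting-recolour G X f v c0 c1 (respecting c0) (p⊆p∪q ⁅ v ⁆) S₀+v⊆X
        (λ _ → q⊆p∪q (S c0) ⁅ v ⁆ (x∈⁅x⁆ v)) (λ ())))
    (ℕ.≤-trans (∣p∪q∣≤∣p∣+∣q∣ (S c0) ⁅ v ⁆)
      (ℕ.≤-reflexive (trans (cong (∣ S c0 ∣ +_) (∣⁅x⁆∣≡1 v)) (ℕ.+-comm _ 1))))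
    where
    S₀+v⊆X : S c0 ∪ ⁅ v ⁆ ⊆ X
    S₀+v⊆X m with x∈p∪q⁻ (S c0) ⁅ v ⁆ m
    ... | inj₁ m′ = proj₁ (respecting c0) m′
    ... | inj₂ m′ = subst (_∈ X) (≡-sym (x∈⁅y⁆⇒x≡y v m′)) v∈X

  ∣S∣≤∣S₁∣ : ∀ j → ∣ S j ∣ ≤ ∣ S c1 ∣
  ∣S∣≤∣S₁∣ c1  = ℕ.≤-refl
  ∣S∣≤∣S₁∣ c0  = ℕ.≤-trans ∣S₀∣≤∣S₀̂∣ ∣S₀̂∣≤∣S₁∣
  ∣S∣≤∣S₁∣ c0̂ = ∣S₀̂∣≤∣S₁∣

module Restriction {n : ℕ} {G : Graph n} {v : Fin n} {X Y : Subset n}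
  (connected : Connected G ⊤) (sep : Separation G v X Y) (f : Fin n → Colour) where
  open Separation sep
  open OneSide connected sep

  respecting-down : ∀ i {S} → Respecting G ⊤ f S → (i ≡ c1 → v ∈ S) →
    (i ≡ c0̂ → SimDominated G X (S ∩ X) v) → Respecting G X (recolour f v i) (S ∩ X)
  respecting-down i {S} (_ , ones , hats) at-v₁ at-v₀̂ =
    p∩q⊆q S X ,
    (λ u u∈X → at-colour f v i c1 (_∈ S ∩ X) u (λ e → x∈p∩q⁺ (at-v₁ e , v∈X))
                 (λ _ e → x∈p∩q⁺ (ones u ∈⊤ e , u∈X))) ,
    (λ u u∈X → at-colour f v i c0̂ (SimDominated G X (S ∩ X)) u at-v₀̂
                 (λ u≢v e → dominated-down u∈X u≢v (hats u ∈⊤ e)))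

-- An f-respecting set S of G restricts to respecting sets of the two sides whose
-- sizes add up to at most ∣ S ∣ (+ 1 if v ∈ S); conversely the proposed unions
-- respect f.
module Combination {n : ℕ} {G : Graph n} {v : Fin n} {X Y : Subset n} (f : Fin n → Colour)
  (connected : Connected G ⊤) (sep : Separation G v X Y)
  (SX SY : Colour → Subset n)
  (minX : ∀ i → MinRespecting G X (recolour f v i) (SX i))
  (minY : ∀ i → MinRespecting G Y (recolour f v i) (SY i)) where

  open Separation sep
  module X  = OneSide connected sep
  module Y  = OneSide connected (swap sep)
  module RX = Restriction connected sep f
  module RY = Restriction connected (swap sep) f
  module BX = ColourBounds G X f v v∈X SX minX
  module BY = ColourBounds G Y f v v∈Y SY minY
  open ℕ.≤-Reasoning

  a b : Colour → ℕ
  a i = ∣ SX i ∣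
  b i = ∣ SY i ∣

  respecting-up : ∀ i j {A C} → Respecting G X (recolour f v i) A → Respecting G Y (recolour f v j) C →
    (f v ≡ c1 → v ∈ A ∪ C) → (f v ≡ c0̂ → SimDominated G ⊤ (A ∪ C) v) → Respecting G ⊤ f (A ∪ C)
  respecting-up i j {A} {C} (_ , onesA , hatsA) (_ , onesC , hatsC) at-v₁ at-v₀̂ =
    (λ _ → ∈⊤) , ones , hats
    where
    ones : ∀ u → u ∈ ⊤ → f u ≡ c1 → u ∈ A ∪ C
    ones u _ e with u ≟ v
    ... | yes refl = at-v₁ e
    ... | no  u≢v with u ∈? X
    ...   | yes u∈X = p⊆p∪q C (onesA u u∈X (trans (recolour-away f v i u≢v) e))
    ...   | no  u∉X = q⊆p∪q A C (onesC u (cover u∉X) (trans (recolour-away f v j u≢v) e))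
    hats : ∀ u → u ∈ ⊤ → f u ≡ c0̂ → SimDominated G ⊤ (A ∪ C) u
    hats u _ e with u ≟ v
    ... | yes refl = at-v₀̂ e
    ... | no  u≢v with u ∈? X
    ...   | yes u∈X = X.dominated-up (p⊆p∪q C) (hatsA u u∈X (trans (recolour-away f v i u≢v) e))
    ...   | no  u∉X =
      Y.dominated-up (q⊆p∪q A C) (hatsC u (cover u∉X) (trans (recolour-away f v j u≢v) e))

  module LowerBounds {S : Subset n} (resp : Respecting G ⊤ f S) where

    pieces⊆S : (S ∩ X) ∪ (S ∩ Y) ⊆ S
    pieces⊆S m with x∈p∪q⁻ (S ∩ X) (S ∩ Y) m
    ... | inj₁ m′ = proj₁ (x∈p∩q⁻ S X m′)
    ... | inj₂ m′ = proj₁ (x∈p∩q⁻ S Y m′)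

    shared⊆v : (S ∩ X) ∩ (S ∩ Y) ⊆ ⁅ v ⁆
    shared⊆v {u} m = subst (_∈ ⁅ v ⁆) (≡-sym (meet u∈X u∈Y)) (x∈⁅x⁆ v)
      where
      u∈X : u ∈ X
      u∈X = proj₂ (x∈p∩q⁻ S X (p∩q⊆p (S ∩ X) (S ∩ Y) m))
      u∈Y : u ∈ Y
      u∈Y = proj₂ (x∈p∩q⁻ S Y (p∩q⊆q (S ∩ X) (S ∩ Y) m))

    pieces-with-v : ∣ S ∩ X ∣ + ∣ S ∩ Y ∣ ≤ suc ∣ S ∣
    pieces-with-v = begin
      ∣ S ∩ X ∣ + ∣ S ∩ Y ∣ ≤⟨ overlap-bound (S ∩ X) (S ∩ Y) S ⁅ v ⁆ pieces⊆S shared⊆v ⟩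
      ∣ S ∣ + ∣ ⁅ v ⁆ ∣     ≡⟨ cong (∣ S ∣ +_) (∣⁅x⁆∣≡1 v) ⟩
      ∣ S ∣ + 1             ≡⟨ ℕ.+-comm ∣ S ∣ 1 ⟩
      suc ∣ S ∣             ∎

    pieces-without-v : v ∉ S → ∣ S ∩ X ∣ + ∣ S ∩ Y ∣ ≤ ∣ S ∣
    pieces-without-v v∉S = begin
      ∣ S ∩ X ∣ + ∣ S ∩ Y ∣ ≤⟨ overlap-bound (S ∩ X) (S ∩ Y) S ⊥ pieces⊆S no-overlap ⟩
      ∣ S ∣ + ∣ ⊥ {n = n} ∣ ≡⟨ cong (∣ S ∣ +_) (∣⊥∣≡0 n) ⟩
      ∣ S ∣ + 0             ≡⟨ ℕ.+-identityʳ ∣ S ∣ ⟩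
      ∣ S ∣                 ∎
      where
      no-overlap : (S ∩ X) ∩ (S ∩ Y) ⊆ ⊥
      no-overlap m = contradiction
        (subst (_∈ S) (x∈⁅y⁆⇒x≡y v (shared⊆v m)) (proj₁ (x∈p∩q⁻ S X (p∩q⊆p (S ∩ X) (S ∩ Y) m)))) v∉S

    piece-X : ∀ i → (i ≡ c1 → v ∈ S) → (i ≡ c0̂ → SimDominated G X (S ∩ X) v) → a i ≤ ∣ S ∩ X ∣
    piece-X i h₁ h₀̂ = proj₂ (minX i) (S ∩ X) (RX.respecting-down i resp h₁ h₀̂)

    piece-Y : ∀ i → (i ≡ c1 → v ∈ S) → (i ≡ c0̂ → SimDominated G Y (S ∩ Y) v) → b i ≤ ∣ S ∩ Y ∣
    piece-Y i h₁ h₀̂ = proj₂ (minY i) (S ∩ Y) (RY.respecting-down i resp h₁ h₀̂)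

    with-v : v ∈ S → a c1 + b c1 ≤ suc ∣ S ∣
    with-v v∈S = ℕ.≤-trans
      (ℕ.+-mono-≤ (piece-X c1 (λ _ → v∈S) (λ ())) (piece-Y c1 (λ _ → v∈S) (λ ())))
      pieces-with-v

    without-v : v ∉ S → a c0 + b c0 ≤ ∣ S ∣
    without-v v∉S = ℕ.≤-trans
      (ℕ.+-mono-≤ (piece-X c0 (λ ()) (λ ())) (piece-Y c0 (λ ()) (λ ())))
      (pieces-without-v v∉S)

    without-v-dominated : v ∉ S → f v ≡ c0̂ → ¬ ¬ (a c0̂ + b c0 ≤ ∣ S ∣ ⊎ a c0 + b c0̂ ≤ ∣ S ∣)
    without-v-dominated v∉S fv≡c0̂ neither = X.dominated-v (proj₂ (proj₂ resp) v ∈⊤ fv≡c0̂) λ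
      { (inj₁ dom) → neither (inj₁ (ℕ.≤-trans
          (ℕ.+-mono-≤ (piece-X c0̂ (λ ()) (λ _ → dom)) (piece-Y c0 (λ ()) (λ ())))
          (pieces-without-v v∉S)))
      ; (inj₂ dom) → neither (inj₂ (ℕ.≤-trans
          (ℕ.+-mono-≤ (piece-X c0 (λ ()) (λ ())) (piece-Y c0̂ (λ ()) (λ _ → dom)))
          (pieces-without-v v∉S))) }

    v∈S-if-1 : f v ≡ c1 → v ∈ S
    v∈S-if-1 = proj₁ (proj₂ resp) v ∈⊤

  v-dominated-X : SimDominated G X (SX c0̂) v
  v-dominated-X = proj₂ (proj₂ (BX.respecting c0̂)) v v∈X (recolour-at f v c0̂)

  v-dominated-Y : SimDominated G Y (SY c0̂) v
  v-dominated-Y = proj₂ (proj₂ (BY.respecting c0̂)) v v∈Y (recolour-at f v c0̂)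

  single-colour : ∀ {j c} → f v ≡ j → f v ≡ c → j ≡ c
  single-colour fv≡j fv≡c = trans (≡-sym fv≡j) fv≡c

  -- The candidate of (b) respects f: v is in it if f v = 1 and dominated
  -- within G[Y] if f v = 0̂.
  respecting-b : ∀ j → f v ≡ j → Respecting G ⊤ f (SX c0 ∪ SY j)
  respecting-b c1  fv≡1  = respecting-up c0 c1 (BX.respecting c0) (BY.respecting c1)
    (λ _ → q⊆p∪q (SX c0) (SY c1) BY.v∈S₁)
    (λ fv≡0̂ → contradiction (single-colour fv≡1 fv≡0̂) λ ())
  respecting-b c0  fv≡0  = respecting-up c0 c0 (BX.respecting c0) (BY.respecting c0)
    (λ fv≡1 → contradiction (single-colour fv≡0 fv≡1) λ ())
    (λ fv≡0̂ → contradiction (single-colour fv≡0 fv≡0̂) λ ())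
  respecting-b c0̂ fv≡0̂ = respecting-up c0 c0̂ (BX.respecting c0) (BY.respecting c0̂)
    (λ fv≡1 → contradiction (single-colour fv≡0̂ fv≡1) λ ())
    (λ _ → Y.dominated-up (q⊆p∪q (SX c0) (SY c0̂)) v-dominated-Y)

  -- The candidate of (c) respects f: v is in it if f v = 1 and it is always
  -- dominated within G[X].
  respecting-c : ∀ j → f v ≡ j → Respecting G ⊤ f (SX c0̂ ∪ SY (best j c0))
  respecting-c c1  _     = respecting-up c0̂ c1 (BX.respecting c0̂) (BY.respecting c1)
    (λ _ → q⊆p∪q (SX c0̂) (SY c1) BY.v∈S₁)
    (λ _ → X.dominated-up (p⊆p∪q (SY c1)) v-dominated-X)
  respecting-c c0  fv≡0  = respecting-up c0̂ c0 (BX.respecting c0̂) (BY.respecting c0)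
    (λ fv≡1 → contradiction (single-colour fv≡0 fv≡1) λ ())
    (λ _ → X.dominated-up (p⊆p∪q (SY c0)) v-dominated-X)
  respecting-c c0̂ fv≡0̂ = respecting-up c0̂ c0 (BX.respecting c0̂) (BY.respecting c0)
    (λ fv≡1 → contradiction (single-colour fv≡0̂ fv≡1) λ ())
    (λ _ → X.dominated-up (p⊆p∪q (SY c0)) v-dominated-X)

  -- (a): SX c1 ∪ SY c1 contains v twice over, saving one vertex.
  part-a : a c0 ≡ a c0̂ → a c0̂ ≡ a c1 → MinRespecting G ⊤ f (SX c1 ∪ SY c1)
  part-a a₀≡a₀̂ a₀̂≡a₁ = respecting , minimal
    where
    v∈∪ : v ∈ SX c1 ∪ SY c1
    v∈∪ = p⊆p∪q (SY c1) BX.v∈S₁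
    respecting : Respecting G ⊤ f (SX c1 ∪ SY c1)
    respecting = respecting-up c1 c1 (BX.respecting c1) (BY.respecting c1)
      (λ _ → v∈∪) (λ _ _ _ → inj₁ v∈∪)
    minimal : ∀ S → Respecting G ⊤ f S → ∣ SX c1 ∪ SY c1 ∣ ≤ ∣ S ∣
    minimal S resp with v ∈? S
    ... | yes v∈S = s≤s⁻¹ (begin
      suc ∣ SX c1 ∪ SY c1 ∣ ≤⟨ shared-element (SX c1) (SY c1) BX.v∈S₁ BY.v∈S₁ ⟩
      a c1 + b c1           ≤⟨ with-v v∈S ⟩
      suc ∣ S ∣             ∎)
      where open LowerBounds resp
    ... | no v∉S = s≤s⁻¹ (begin
      suc ∣ SX c1 ∪ SY c1 ∣ ≤⟨ shared-element (SX c1) (SY c1) BX.v∈S₁ BY.v∈S₁ ⟩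
      a c1 + b c1           ≤⟨ ℕ.+-mono-≤ (ℕ.≤-reflexive (≡-sym (trans a₀≡a₀̂ a₀̂≡a₁))) BY.∣S₁∣≤1+∣S₀∣ ⟩
      a c0 + suc (b c0)     ≡⟨ ℕ.+-suc (a c0) (b c0) ⟩
      suc (a c0 + b c0)     ≤⟨ s≤s (without-v v∉S) ⟩
      suc ∣ S ∣             ∎)
      where open LowerBounds resp

  part-b : a c0 < a c0̂ → a c0̂ ≡ a c1 → ∀ j → f v ≡ j → MinRespecting G ⊤ f (SX c0 ∪ SY j)
  part-b a₀<a₀̂ a₀̂≡a₁ j fv≡j = respecting-b j fv≡j , minimal
    where
    minimal : ∀ S → Respecting G ⊤ f S → ∣ SX c0 ∪ SY j ∣ ≤ ∣ S ∣
    minimal S resp with v ∈? S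
    ... | yes v∈S = s≤s⁻¹ (begin
      suc ∣ SX c0 ∪ SY j ∣ ≤⟨ s≤s (∣p∪q∣≤∣p∣+∣q∣ (SX c0) (SY j)) ⟩
      suc (a c0 + b j)     ≤⟨ ℕ.+-mono-≤ a₀<a₀̂ (BY.∣S∣≤∣S₁∣ j) ⟩
      a c0̂ + b c1          ≡⟨ cong (_+ b c1) a₀̂≡a₁ ⟩
      a c1 + b c1          ≤⟨ with-v v∈S ⟩
      suc ∣ S ∣            ∎)
      where open LowerBounds resp
    ... | no v∉S = without j fv≡j
      where
      open LowerBounds resp
      without : ∀ j → f v ≡ j → ∣ SX c0 ∪ SY j ∣ ≤ ∣ S ∣
      without c1  fv≡1  = contradiction (v∈S-if-1 fv≡1) v∉S
      without c0  _     = ℕ.≤-trans (∣p∪q∣≤∣p∣+∣q∣ (SX c0) (SY c0)) (without-v v∉S)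
      without c0̂ fv≡0̂ = decidable-stable (_ ≤? _) λ ¬bound → without-v-dominated v∉S fv≡0̂ λ
        { (inj₁ dominated-in-X) → ¬bound (begin
            ∣ SX c0 ∪ SY c0̂ ∣ ≤⟨ ∣p∪q∣≤∣p∣+∣q∣ (SX c0) (SY c0̂) ⟩
            a c0 + b c0̂       ≤⟨ ℕ.+-monoʳ-≤ (a c0) (ℕ.≤-trans BY.∣S₀̂∣≤∣S₁∣ BY.∣S₁∣≤1+∣S₀∣) ⟩
            a c0 + suc (b c0) ≡⟨ ℕ.+-suc (a c0) (b c0) ⟩
            suc (a c0) + b c0 ≤⟨ ℕ.+-monoˡ-≤ (b c0) a₀<a₀̂ ⟩
            a c0̂ + b c0       ≤⟨ dominated-in-X ⟩
            ∣ S ∣             ∎)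
        ; (inj₂ dominated-in-Y) → ¬bound (ℕ.≤-trans (∣p∪q∣≤∣p∣+∣q∣ (SX c0) (SY c0̂)) dominated-in-Y) }

  part-c : a c0 ≡ a c0̂ → a c0̂ < a c1 → ∀ j → f v ≡ j → MinRespecting G ⊤ f (SX c0̂ ∪ SY (best j c0))
  part-c a₀≡a₀̂ a₀̂<a₁ j fv≡j = respecting-c j fv≡j , minimal
    where
    minimal : ∀ S → Respecting G ⊤ f S → ∣ SX c0̂ ∪ SY (best j c0) ∣ ≤ ∣ S ∣
    minimal S resp with v ∈? S
    ... | yes v∈S = s≤s⁻¹ (begin
      suc ∣ SX c0̂ ∪ SY (best j c0) ∣ ≤⟨ s≤s (∣p∪q∣≤∣p∣+∣q∣ (SX c0̂) (SY (best j c0))) ⟩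
      suc (a c0̂ + b (best j c0))    ≤⟨ ℕ.+-mono-≤ a₀̂<a₁ (BY.∣S∣≤∣S₁∣ (best j c0)) ⟩
      a c1 + b c1                   ≤⟨ with-v v∈S ⟩
      suc ∣ S ∣                     ∎)
      where open LowerBounds resp
    ... | no v∉S = without j fv≡j
      where
      open LowerBounds resp
      -- Here f v ≠ 1, so best j c0 = c0.
      without-0 : ∣ SX c0̂ ∪ SY c0 ∣ ≤ ∣ S ∣
      without-0 = begin
        ∣ SX c0̂ ∪ SY c0 ∣ ≤⟨ ∣p∪q∣≤∣p∣+∣q∣ (SX c0̂) (SY c0) ⟩
        a c0̂ + b c0       ≡⟨ cong (_+ b c0) (≡-sym a₀≡a₀̂) ⟩
        a c0 + b c0       ≤⟨ without-v v∉S ⟩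
        ∣ S ∣             ∎
      without : ∀ j → f v ≡ j → ∣ SX c0̂ ∪ SY (best j c0) ∣ ≤ ∣ S ∣
      without c1  fv≡1 = contradiction (v∈S-if-1 fv≡1) v∉S
      without c0  _    = without-0
      without c0̂ _    = without-0

  lemma : (a c0 ≡ a c0̂ → a c0̂ ≡ a c1 → MinRespecting G ⊤ f (SX c1 ∪ SY c1))
        × (a c0 < a c0̂ → a c0̂ ≡ a c1 → MinRespecting G ⊤ f (SX c0 ∪ SY (f v)))
        × (a c0 ≡ a c0̂ → a c0̂ < a c1 → MinRespecting G ⊤ f (SX c0̂ ∪ SY (best (f v) c0)))
  lemma = part-a , (λ h₁ h₂ → part-b h₁ h₂ (f v) refl) , (λ h₁ h₂ → part-c h₁ h₂ (f v) refl)

-- A block B containing only the cut vertex v separates G at v from the rest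
-- G - (B - v), whose vertex set is ∁ B ∪ ⁅ v ⁆.
block-separation : {n : ℕ} (G : Graph n) (B : Subset n) (v : Fin n) →
  Connected G ⊤ → IsBlock G B → v ∈ B → (∀ u → u ∈ B → CutVertex G ⊤ u → u ≡ v) →
  Separation G v B (∁ B ∪ ⁅ v ⁆)
block-separation G B v connected block v∈B only-cut = record
  { v∈X = v∈B
  ; v∈Y = x∈p∪q⁺ (inj₂ (x∈⁅x⁆ v))
  ; cover = λ u∉B → x∈p∪q⁺ (inj₁ (x∉p⇒x∈∁p u∉B))
  ; meet = meet
  ; attach = BlockBoundary.leaves-from-v G B v connected block v∈B only-cut }
  where
  meet : ∀ {u} → u ∈ B → u ∈ ∁ B ∪ ⁅ v ⁆ → u ≡ v
  meet {u} u∈B m with x∈p∪q⁻ (∁ B) ⁅ v ⁆ m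
  ... | inj₁ u∈∁B = contradiction u∈B (x∈∁p⇒x∉p u∈∁B)
  ... | inj₂ u∈v  = x∈⁅y⁆⇒x≡y v u∈v

-- Lemma 9: B - v is a leaf component with connection vertex v, H′ = G[B] and
-- G - H = G[∁ B ∪ ⁅ v ⁆].
lemma9 : {n : ℕ} (G : Graph n) (f : Fin n → Colour) (B : Subset n) (v : Fin n) →
    Connected G ⊤ → IsBlock G B → v ∈ B → CutVertex G ⊤ v →
    (∀ u → u ∈ B → CutVertex G ⊤ u → u ≡ v) →
    (SH SGH : Colour → Subset n) →
    (∀ i → MinRespecting G B (recolour f v i) (SH i)) →
    (∀ i → MinRespecting G (∁ B ∪ ⁅ v ⁆) (recolour f v i) (SGH i)) →
    ((∣ SH c0 ∣ ≡ ∣ SH c0̂ ∣ → ∣ SH c0̂ ∣ ≡ ∣ SH c1 ∣ →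
        MinRespecting G ⊤ f (SH c1 ∪ SGH c1))
    × (∣ SH c0 ∣ < ∣ SH c0̂ ∣ → ∣ SH c0̂ ∣ ≡ ∣ SH c1 ∣ →
        MinRespecting G ⊤ f (SH c0 ∪ SGH (f v)))
    × (∣ SH c0 ∣ ≡ ∣ SH c0̂ ∣ → ∣ SH c0̂ ∣ < ∣ SH c1 ∣ →
        MinRespecting G ⊤ f (SH c0̂ ∪ SGH (best (f v) c0))))
lemma9 G f B v connected block v∈B _ only-cut SH SGH minH minGH =
  Combination.lemma f connected (block-separation G B v connected block v∈B only-cut) SH SGH minH minGH
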